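{- Let $n$ be an even positive integer and let $x$ be a Hall number with $x > 10^{18}$. If $x = n^2 + a$ with $a$ an integer, $1 \le a \le 2n$, then $a > \sqrt[3]{6}\,(n-1)^{2/3}$. If $x = n^2 - a$ with $a$ an integer, $1 \le a \le 2n-2$, then $a > 2(n-1)^{2/3} - 1$.
   Context: For a positive integer $x$ that is not a perfect square, let $k_x$ denote the distance between $x^3$ and the perfect square closest to $x^3$, and $r_x = \sqrt{x}/k_x$; a Hall number is a non-square positive integer $x$ with $r_x > 1$. -}

module Defs where

open import Data.Nat using (ℕ; _*_; _^_; _<_; _≤_; ∣_-_∣)
open import Data.Product using (Σ; _×_; ∃-syntax)
open import Relation.Binary.PropositionalEquality using (_≡_)
open import Relation.Nullary using (¬_)

IsSquare : ℕ → Set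
IsSquare x = ∃[ m ] (m * m ≡ x)

DistToNearestSquare : ℕ → ℕ → Set
DistToNearestSquare N k = (∃[ m ] (∣ N - m * m ∣ ≡ k)) × (∀ m → k ≤ ∣ N - m * m ∣)

-- Hall number: non-square x with r_x = sqrt(x) / k_x > 1,
-- where k_x is the distance from x^3 to the nearest square.
-- Since k_x ≥ 0, sqrt(x)/k_x > 1 ⟺ k_x < sqrt x ⟺ k_x * k_x < x.
IsHall : ℕ → Set
IsHall x = ¬ IsSquare x × (∃[ k ] (DistToNearestSquare (x ^ 3) k × k * k < x))

module Submission where

-- Write n = 2p. For x = n² + a put Q = 8p² + 3a, so that 8x³ + a³ = 8(pQ)² + 3a²Q; for x = n² − a
-- put z = 8p² − 3a, so that 8x³ = 8(pz)² + 3a²z + a³. Being a Hall number puts a square y² within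
-- 2p of x³. For y ≤ pQ (resp. pz) the term 3a²Q (resp. 3a²z) is already too large. For
-- y = pQ + t (resp. pz + t), 8(x³ − y²) equals (3a² − 16pt)·Q (resp. ·z) up to the small terms a³
-- and 8t², and Q, z ≈ 8p², so 16pt must match 3a² almost exactly. As 3a² ≡ 0, 3 or 4 (mod 8) and
-- 16pt ≡ 0, the mismatch is 0 or at least 3 (resp. 4); when a is as small as the negated bound
-- says, each case forces p < 100, contradicting x > 10¹⁸.

open import Defs
open import Data.Nat
open import Data.Nat.Properties
open import Data.Nat.DivMod using (_%_; [m+kn]%n≡m%n; %-distribˡ-+; m*n%n≡0)
open import Data.Nat.Divisibility using (_∣_; divides)
open import Data.Nat.Tactic.RingSolver using (solve; solve-∀)
open import Data.List using (_∷_; [])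
open import Data.Product using (_×_; _,_; ∃-syntax)
open import Data.Bool using (T)
open import Data.Empty using (⊥)
open import Relation.Nullary using (¬_; yes; no)
open import Relation.Binary.Definitions using (tri<; tri≈; tri>)
open import Relation.Binary.PropositionalEquality

∣-∣-balance : ∀ c A B X Z → c * A + X ≡ c * B + Z → Z ≤ X + c * ∣ A - B ∣
∣-∣-balance c A B X Z e = +-cancelˡ-≤ (c * B) _ _ (begin
  c * B + Z                   ≡⟨ e ⟨
  c * A + X                   ≤⟨ +-monoˡ-≤ X (*-monoʳ-≤ c (m≤n+∣m-n∣ A B)) ⟩
  c * (B + ∣ A - B ∣) + X     ≡⟨ regroup c B X ∣ A - B ∣ ⟩
  c * B + (X + c * ∣ A - B ∣) ∎)
  where
  open ≤-Reasoning
  regroup : ∀ c B X d → c * (B + d) + X ≡ c * B + (X + c * d)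
  regroup = solve-∀

∣-∣-balance′ : ∀ c A B X Z → c * A + X ≡ c * B + Z → X ≤ Z + c * ∣ A - B ∣
∣-∣-balance′ c A B X Z e rewrite ∣-∣-comm A B = ∣-∣-balance c B A Z X (sym e)

data Residue3n² : ℕ → Set where
  0ʳ : Residue3n² 0
  3ʳ : Residue3n² 3
  4ʳ : Residue3n² 4

3[4+n]²≡3n²+[3n+6]*8 : ∀ n → 3 * (4 + n) * (4 + n) ≡ 3 * n * n + (3 * n + 6) * 8
3[4+n]²≡3n²+[3n+6]*8 = solve-∀

3n²%8-residue : ∀ n → Residue3n² (3 * n * n % 8)
3n²%8-residue 0 = 0ʳ
3n²%8-residue 1 = 3ʳ
3n²%8-residue 2 = 4ʳ
3n²%8-residue 3 = 3ʳ
3n²%8-residue (suc (suc (suc (suc n)))) = subst Residue3n² (sym period) (3n²%8-residue n)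
  where
  period : 3 * (4 + n) * (4 + n) % 8 ≡ 3 * n * n % 8
  period = trans (cong (_% 8) (3[4+n]²≡3n²+[3n+6]*8 n)) ([m+kn]%n≡m%n (3 * n * n) (3 * n + 6) 8)

8w<3n²⇒8w+3≤3n² : ∀ w n → w * 8 < 3 * n * n → w * 8 + 3 ≤ 3 * n * n
8w<3n²⇒8w+3≤3n² w n lt with m≤n⇒∃[o]m+o≡n lt
... | o , e = gap o e (subst Residue3n² 3n²%8≡[1+o]%8 (3n²%8-residue n))
  where
  3n²%8≡[1+o]%8 : 3 * n * n % 8 ≡ suc o % 8
  3n²%8≡[1+o]%8 = begin
    3 * n * n % 8           ≡⟨ cong (_% 8) e ⟨
    (suc (w * 8) + o) % 8   ≡⟨ cong (λ m → suc m % 8) (+-comm (w * 8) o) ⟩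
    (suc o + w * 8) % 8     ≡⟨ [m+kn]%n≡m%n (suc o) w 8 ⟩
    suc o % 8               ∎
    where open ≡-Reasoning
  gap : ∀ o → suc (w * 8) + o ≡ 3 * n * n → Residue3n² (suc o % 8) → w * 8 + 3 ≤ 3 * n * n
  gap 0 _ ()
  gap 1 _ ()
  gap (suc (suc o)) e _ = subst (w * 8 + 3 ≤_) (trans (+-suc (w * 8) (suc (suc o))) e) (+-monoʳ-≤ (w * 8) (s≤s (s≤s (s≤s z≤n))))

3n²<8w⇒3n²+4≤8w : ∀ n w → 3 * n * n < w * 8 → 3 * n * n + 4 ≤ w * 8
3n²<8w⇒3n²+4≤8w n w lt with m≤n⇒∃[o]m+o≡n lt
... | o , e = gap o e (3n²%8-residue n) [3n²%8+[1+o]%8]%8≡0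
  where
  [3n²%8+[1+o]%8]%8≡0 : (3 * n * n % 8 + suc o % 8) % 8 ≡ 0
  [3n²%8+[1+o]%8]%8≡0 = begin
    (3 * n * n % 8 + suc o % 8) % 8 ≡⟨ %-distribˡ-+ (3 * n * n) (suc o) 8 ⟨
    (3 * n * n + suc o) % 8         ≡⟨ cong (_% 8) (trans (+-suc _ o) e) ⟩
    w * 8 % 8                       ≡⟨ m*n%n≡0 w 8 ⟩
    0                               ∎
    where open ≡-Reasoning
  gap : ∀ {r} o → suc (3 * n * n) + o ≡ w * 8 → Residue3n² r → (r + suc o % 8) % 8 ≡ 0 → 3 * n * n + 4 ≤ w * 8
  gap 0 _ 0ʳ ()
  gap 0 _ 3ʳ ()
  gap 0 _ 4ʳ ()
  gap 1 _ 0ʳ ()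
  gap 1 _ 3ʳ ()
  gap 1 _ 4ʳ ()
  gap 2 _ 0ʳ ()
  gap 2 _ 3ʳ ()
  gap 2 _ 4ʳ ()
  gap (suc (suc (suc o))) e _ _ = subst (3 * n * n + 4 ≤_) (trans (+-suc (3 * n * n) (suc (suc (suc o)))) e) (+-monoʳ-≤ (3 * n * n) (s≤s (s≤s (s≤s (s≤s z≤n)))))

16pt<3a²⇒t³<7p : ∀ p a t → a * a * a ≤ 32 * (p * p) → 16 * p * t < 3 * a * a → t * t * t < 7 * p
16pt<3a²⇒t³<7p p a t a³≤ lt = *-cancelʳ-< (4096 * (p * p * p)) (t * t * t) (7 * p) (begin-strict
  t * t * t * (4096 * (p * p * p))         ≡⟨ solve (p ∷ t ∷ []) ⟩
  16 * p * t * (16 * p * t) * (16 * p * t) <⟨ *-mono-< (*-mono-< lt lt) lt ⟩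
  3 * a * a * (3 * a * a) * (3 * a * a)    ≡⟨ solve (a ∷ []) ⟩
  27 * (a * a * a * (a * a * a))           ≤⟨ *-monoʳ-≤ 27 (*-mono-≤ a³≤ a³≤) ⟩
  27 * (32 * (p * p) * (32 * (p * p)))     ≡⟨ solve (p ∷ []) ⟩
  27648 * (p * p * p * p)                  ≤⟨ *-monoˡ-≤ (p * p * p * p) (≤ᵇ⇒≤ 27648 28672 _) ⟩
  28672 * (p * p * p * p)                  ≡⟨ solve (p ∷ []) ⟩
  7 * p * (4096 * (p * p * p))             ∎)
  where open ≤-Reasoning

t³<7p⇒t²<p : ∀ p t → 49 ≤ p → t * t * t < 7 * p → t * t < p
t³<7p⇒t²<p p t 49≤p t³<7p = ≰⇒> λ p≤t² → <⇒≱ (p<49 p≤t²) 49≤p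
  where
  open ≤-Reasoning
  p<49 : p ≤ t * t → p < 49
  p<49 p≤t² = *-cancelʳ-< (p * p) p 49 (begin-strict
    p * (p * p)                   ≡⟨ solve (p ∷ []) ⟩
    p * p * p                     ≤⟨ *-mono-≤ (*-mono-≤ p≤t² p≤t²) p≤t² ⟩
    t * t * (t * t) * (t * t)     ≡⟨ solve (t ∷ []) ⟩
    t * t * t * (t * t * t)       <⟨ *-mono-< t³<7p t³<7p ⟩
    7 * p * (7 * p)               ≡⟨ solve (p ∷ []) ⟩
    49 * (p * p)                  ∎)

split-at : ∀ (P : ℕ → Set) m → (∀ y → y ≤ m → P y) → (∀ t → 1 ≤ t → P (m + t)) → ∀ y → P y
split-at P m below above y with y ≤? m
... | yes y≤m = below y y≤m
... | no y≰m with m≤n⇒∃[o]m+o≡n (≰⇒> y≰m)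
...   | o , m+1+o≡y = subst P (trans (+-suc m o) m+1+o≡y) (above (suc o) (s≤s z≤n))

n*n≤m*n⇒n≤m : ∀ m n → n * n ≤ m * n → n ≤ m
n*n≤m*n⇒n≤m m zero    _  = z≤n
n*n≤m*n⇒n≤m m (suc n) le = *-cancelʳ-≤ (suc n) m (suc n) le

9n≤3n²+6 : ∀ n → 9 * n ≤ 3 * n * n + 6
9n≤3n²+6 0 = z≤n
9n≤3n²+6 1 = ≤-refl
9n≤3n²+6 2 = ≤-refl
9n≤3n²+6 n@(suc (suc (suc _))) = ≤-trans (*-monoˡ-≤ n (*-monoʳ-≤ 3 {3} {n} (s≤s (s≤s (s≤s z≤n))))) (m≤m+n (3 * n * n) 6)

24p²+a³≤3a²[8p²+3a] : ∀ p a → 1 ≤ a → 24 * (p * p) + a * a * a ≤ 3 * a * a * (8 * (p * p) + 3 * a)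
24p²+a³≤3a²[8p²+3a] p a 1≤a = begin
  24 * (p * p) + a * a * a               ≤⟨ +-mono-≤ (m≤m*n (24 * (p * p)) (a * a) {{>-nonZero (*-mono-≤ 1≤a 1≤a)}}) (m≤n*m (a * a * a) 9) ⟩
  24 * (p * p) * (a * a) + 9 * (a * a * a) ≡⟨ solve (p ∷ a ∷ []) ⟩
  3 * a * a * (8 * (p * p) + 3 * a)       ∎
  where open ≤-Reasoning

16pt≡2pt*8 : ∀ p t → 16 * p * t ≡ 2 * p * t * 8
16pt≡2pt*8 = solve-∀

cube-expansion⁺₀ : ∀ p a → let x = 4 * (p * p) + a; Q = 8 * (p * p) + 3 * a in
  8 * (x * x * x) + a * a * a ≡ 8 * (p * Q * (p * Q)) + 3 * a * a * Q
cube-expansion⁺₀ = solve-∀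

cube-expansion⁺ : ∀ p a t → let x = 4 * (p * p) + a; Q = 8 * (p * p) + 3 * a in
  8 * (x * x * x) + (16 * p * t * Q + (a * a * a + 8 * t * t)) ≡ 8 * ((p * Q + t) * (p * Q + t)) + 3 * a * a * Q
cube-expansion⁺ = solve-∀

module _ {p : ℕ} (99<p : 99 < p) where

  private instance
    p≢0 : NonZero p
    p≢0 = >-nonZero (≤-trans (s≤s z≤n) 99<p)

  p≰ : ∀ c → {T (c ≤ᵇ 99)} → ¬ p ≤ c
  p≰ c {c≤99} p≤c = <⇒≱ 99<p (≤-trans p≤c (≤ᵇ⇒≤ c 99 c≤99))

  16pt<3a²⇒t²<p : ∀ a t → a * a * a ≤ 32 * (p * p) → 16 * p * t < 3 * a * a → t * t < p
  16pt<3a²⇒t²<p a t a³≤32p² lt = t³<7p⇒t²<p p t (≤-trans (≤ᵇ⇒≤ 49 100 _) 99<p) (16pt<3a²⇒t³<7p p a t a³≤32p² lt)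

  module AboveSquare (a : ℕ) (1≤a : 1 ≤ a) (a³+24p≤24p²+6 : a * a * a + 24 * p ≤ 24 * (p * p) + 6) where

    x Q : ℕ
    x = 4 * (p * p) + a
    Q = 8 * (p * p) + 3 * a

    far-≤ : ∀ y → y ≤ p * Q → ¬ ∣ x * x * x - y * y ∣ ≤ 2 * p
    far-≤ y y≤pQ near with m≤n⇒∃[o]m+o≡n (*-mono-≤ y≤pQ y≤pQ)
    ... | d , y²+d≡[pQ]² = p≰ 16 (n*n≤m*n⇒n≤m 16 p (≤-trans (m≤n*m (p * p) 24) 24p²≤16p))
      where
      open ≤-Reasoning
      balance : 8 * (x * x * x) + a * a * a ≡ 8 * (y * y) + (8 * d + 3 * a * a * Q)
      balance = begin-equality
        8 * (x * x * x) + a * a * a       ≡⟨ cube-expansion⁺₀ p a ⟩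
        8 * (p * Q * (p * Q)) + 3 * a * a * Q ≡⟨ cong (λ s → 8 * s + 3 * a * a * Q) y²+d≡[pQ]² ⟨
        8 * (y * y + d) + 3 * a * a * Q    ≡⟨ cong (_+ 3 * a * a * Q) (*-distribˡ-+ 8 (y * y) d) ⟩
        8 * (y * y) + 8 * d + 3 * a * a * Q ≡⟨ +-assoc (8 * (y * y)) (8 * d) _ ⟩
        8 * (y * y) + (8 * d + 3 * a * a * Q) ∎
      24p²≤16p : 24 * (p * p) ≤ 16 * p
      24p²≤16p = +-cancelʳ-≤ (a * a * a) _ _ (begin
        24 * (p * p) + a * a * a            ≤⟨ 24p²+a³≤3a²[8p²+3a] p a 1≤a ⟩
        3 * a * a * Q                       ≤⟨ m≤n+m _ (8 * d) ⟩
        8 * d + 3 * a * a * Q               ≤⟨ ∣-∣-balance 8 (x * x * x) (y * y) _ _ balance ⟩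
        a * a * a + 8 * ∣ x * x * x - y * y ∣ ≤⟨ +-monoʳ-≤ (a * a * a) (*-monoʳ-≤ 8 near) ⟩
        a * a * a + 8 * (2 * p)             ≡⟨ +-comm (a * a * a) _ ⟩
        8 * (2 * p) + a * a * a             ≡⟨ cong (_+ a * a * a) (*-assoc 8 2 p) ⟨
        16 * p + a * a * a                  ∎)

    module _ (t : ℕ) (near : ∣ x * x * x - (p * Q + t) * (p * Q + t) ∣ ≤ 2 * p) where

      private
        k : ℕ
        k = ∣ x * x * x - (p * Q + t) * (p * Q + t) ∣
        8k≤16p : 8 * k ≤ 8 * (2 * p)
        8k≤16p = *-monoʳ-≤ 8 near

      up : 16 * p * t * Q + (a * a * a + 8 * t * t) ≤ 3 * a * a * Q + 8 * (2 * p)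
      up = ≤-trans (∣-∣-balance′ 8 (x * x * x) _ (16 * p * t * Q + (a * a * a + 8 * t * t)) (3 * a * a * Q) (cube-expansion⁺ p a t))
                   (+-monoʳ-≤ (3 * a * a * Q) 8k≤16p)

      down : 3 * a * a * Q ≤ 16 * p * t * Q + (a * a * a + 8 * t * t) + 8 * (2 * p)
      down = ≤-trans (∣-∣-balance 8 (x * x * x) _ (16 * p * t * Q + (a * a * a + 8 * t * t)) (3 * a * a * Q) (cube-expansion⁺ p a t))
                     (+-monoʳ-≤ (16 * p * t * Q + (a * a * a + 8 * t * t)) 8k≤16p)

      overshoot : 3 * a * a < 16 * p * t → ⊥
      overshoot lt = p≰ 16 (n*n≤m*n⇒n≤m 16 p (begin
        p * p            ≤⟨ m≤n*m (p * p) 8 ⟩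
        8 * (p * p)      ≤⟨ m≤m+n _ (3 * a) ⟩
        Q                ≤⟨ +-cancelʳ-≤ (3 * a * a * Q) Q (8 * (2 * p)) Q+3a²Q≤ ⟩
        8 * (2 * p)      ≡⟨ *-assoc 8 2 p ⟨
        16 * p           ∎))
        where
        open ≤-Reasoning
        Q+3a²Q≤ : Q + 3 * a * a * Q ≤ 8 * (2 * p) + 3 * a * a * Q
        Q+3a²Q≤ = begin
          suc (3 * a * a) * Q                           ≤⟨ *-monoˡ-≤ Q lt ⟩
          16 * p * t * Q                                ≤⟨ m≤m+n _ _ ⟩
          16 * p * t * Q + (a * a * a + 8 * t * t)      ≤⟨ up ⟩
          3 * a * a * Q + 8 * (2 * p)                   ≡⟨ +-comm (3 * a * a * Q) _ ⟩
          8 * (2 * p) + 3 * a * a * Q                   ∎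

      exact : 1 ≤ t → 3 * a * a ≡ 16 * p * t → ⊥
      exact 1≤t eq = p≰ 27 (begin
        p              ≤⟨ m≤n*m p 16 ⟩
        16 * p         ≤⟨ 16p≤3a² ⟩
        3 * a * a      ≤⟨ *-mono-≤ (*-monoʳ-≤ 3 a≤3) a≤3 ⟩
        27             ∎)
        where
        open ≤-Reasoning
        16p≤3a² : 16 * p ≤ 3 * a * a
        16p≤3a² = ≤-trans (m≤m*n (16 * p) t {{>-nonZero 1≤t}}) (≤-reflexive (sym eq))
        a³≤3a² : a * a * a ≤ 3 * a * a
        a³≤3a² = begin
          a * a * a                 ≤⟨ m≤m+n _ (8 * t * t) ⟩
          a * a * a + 8 * t * t     ≤⟨ +-cancelˡ-≤ (16 * p * t * Q) _ _ (subst (λ s → 16 * p * t * Q + (a * a * a + 8 * t * t) ≤ s * Q + 8 * (2 * p)) eq up) ⟩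
          8 * (2 * p)               ≡⟨ *-assoc 8 2 p ⟨
          16 * p                    ≤⟨ 16p≤3a² ⟩
          3 * a * a                 ∎
        a≤3 : a ≤ 3
        a≤3 = *-cancelʳ-≤ a 3 a {{>-nonZero 1≤a}} (*-cancelʳ-≤ (a * a) (3 * a) a {{>-nonZero 1≤a}} a³≤3a²)

      undershoot : 16 * p * t < 3 * a * a → ⊥
      undershoot lt = <⇒≱ (≤ᵇ⇒≤ 7 8 _) (≤-trans (m≤n+m 8 (9 * a)) (+-cancelˡ-≤ (24 * (p * p) + 24 * p) _ _ (begin
        24 * (p * p) + 24 * p + (9 * a + 8)                        ≡⟨ solve (p ∷ a ∷ []) ⟩
        3 * (8 * (p * p) + 3 * a) + 24 * p + 8                     ≤⟨ +-monoˡ-≤ 8 (+-monoˡ-≤ (24 * p) 3Q≤) ⟩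
        a * a * a + 8 * t * t + 8 * (2 * p) + 24 * p + 8           ≡⟨ solve (p ∷ a ∷ t ∷ []) ⟩
        (a * a * a + 24 * p) + (8 * t * t + 8) + 8 * (2 * p)       ≤⟨ +-monoˡ-≤ (8 * (2 * p)) (+-mono-≤ a³+24p≤24p²+6 8t²+8≤8p) ⟩
        24 * (p * p) + 6 + 8 * p + 8 * (2 * p)                     ≡⟨ solve (p ∷ []) ⟩
        24 * (p * p) + 24 * p + 6                                  ∎)))
        where
        open ≤-Reasoning
        16pt+3≤3a² : 16 * p * t + 3 ≤ 3 * a * a
        16pt+3≤3a² = subst (λ s → s + 3 ≤ 3 * a * a) (sym (16pt≡2pt*8 p t)) (8w<3n²⇒8w+3≤3n² (2 * p * t) a (subst (_< 3 * a * a) (16pt≡2pt*8 p t) lt))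
        3Q≤ : 3 * Q ≤ a * a * a + 8 * t * t + 8 * (2 * p)
        3Q≤ = +-cancelˡ-≤ (16 * p * t * Q) _ _ (begin
          16 * p * t * Q + 3 * Q                        ≡⟨ *-distribʳ-+ Q (16 * p * t) 3 ⟨
          (16 * p * t + 3) * Q                          ≤⟨ *-monoˡ-≤ Q 16pt+3≤3a² ⟩
          3 * a * a * Q                                 ≤⟨ down ⟩
          16 * p * t * Q + (a * a * a + 8 * t * t) + 8 * (2 * p) ≡⟨ +-assoc (16 * p * t * Q) _ _ ⟩
          16 * p * t * Q + (a * a * a + 8 * t * t + 8 * (2 * p)) ∎)
        a³≤32p² : a * a * a ≤ 32 * (p * p)
        a³≤32p² = begin
          a * a * a                    ≤⟨ m≤m+n _ (24 * p) ⟩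
          a * a * a + 24 * p           ≤⟨ a³+24p≤24p²+6 ⟩
          24 * (p * p) + 6             ≤⟨ +-monoʳ-≤ (24 * (p * p)) (≤-trans (≤ᵇ⇒≤ 6 8 _) (*-monoʳ-≤ 8 (*-mono-≤ (>-nonZero⁻¹ p) (>-nonZero⁻¹ p)))) ⟩
          24 * (p * p) + 8 * (p * p)   ≡⟨ solve (p ∷ []) ⟩
          32 * (p * p)                 ∎
        8t²+8≤8p : 8 * t * t + 8 ≤ 8 * p
        8t²+8≤8p = begin
          8 * t * t + 8                ≡⟨ solve (t ∷ []) ⟩
          8 * suc (t * t)              ≤⟨ *-monoʳ-≤ 8 (16pt<3a²⇒t²<p a t a³≤32p² lt) ⟩
          8 * p                        ∎

    far-shifted : ∀ t → 1 ≤ t → ¬ ∣ x * x * x - (p * Q + t) * (p * Q + t) ∣ ≤ 2 * p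
    far-shifted t 1≤t near with <-cmp (3 * a * a) (16 * p * t)
    ... | tri< lt _ _ = overshoot t near lt
    ... | tri≈ _ eq _ = exact t near 1≤t eq
    ... | tri> _ _ gt = undershoot t near gt

    far : ∀ y → 2 * p < ∣ x * x * x - y * y ∣
    far y = ≰⇒> (split-at (λ y → ¬ ∣ x * x * x - y * y ∣ ≤ 2 * p) (p * Q) far-≤ far-shifted y)

  module BelowSquare (a x : ℕ) (1≤a : 1 ≤ a) (a≤4p : a ≤ 4 * p) (x+a≡4p² : x + a ≡ 4 * (p * p))
                     ([a+1]³+32p≤32p²+8 : (a + 1) * (a + 1) * (a + 1) + 32 * p ≤ 32 * (p * p) + 8) where

    a³≤32p² : a * a * a ≤ 32 * (p * p)
    a³≤32p² = +-cancelʳ-≤ 8 _ _ (begin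
      a * a * a + 8                         ≤⟨ +-mono-≤ (*-mono-≤ (*-mono-≤ a≤a+1 a≤a+1) a≤a+1) (≤-trans (≤ᵇ⇒≤ 8 32 _) (m≤m*n 32 p)) ⟩
      (a + 1) * (a + 1) * (a + 1) + 32 * p  ≤⟨ [a+1]³+32p≤32p²+8 ⟩
      32 * (p * p) + 8                      ∎)
      where
      open ≤-Reasoning
      a≤a+1 : a ≤ a + 1
      a≤a+1 = m≤m+n a 1

    module _ (z : ℕ) (z+3a≡8p² : z + 3 * a ≡ 8 * (p * p)) where

      private
        z+a≡2x : z + a ≡ 2 * x
        z+a≡2x = +-cancelˡ-≡ (2 * a) _ _ (begin
          2 * a + (z + a)   ≡⟨ solve (z ∷ a ∷ []) ⟩
          z + 3 * a         ≡⟨ z+3a≡8p² ⟩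
          8 * (p * p)       ≡⟨ *-assoc 2 4 (p * p) ⟩
          2 * (4 * (p * p)) ≡⟨ cong (2 *_) x+a≡4p² ⟨
          2 * (x + a)       ≡⟨ solve (x ∷ a ∷ []) ⟩
          2 * a + 2 * x     ∎)
          where open ≡-Reasoning

        8x³≡ : 8 * (x * x * x) ≡ 8 * (p * p) * z * z + (3 * a * a * z + a * a * a)
        8x³≡ = begin
          8 * (x * x * x)                                     ≡⟨ solve (x ∷ []) ⟩
          2 * x * (2 * x) * (2 * x)                           ≡⟨ cong (λ s → s * s * s) z+a≡2x ⟨
          (z + a) * (z + a) * (z + a)                         ≡⟨ solve (z ∷ a ∷ []) ⟩
          (z + 3 * a) * z * z + (3 * a * a * z + a * a * a)   ≡⟨ cong (λ s → s * z * z + (3 * a * a * z + a * a * a)) z+3a≡8p² ⟩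
          8 * (p * p) * z * z + (3 * a * a * z + a * a * a)   ∎
          where open ≡-Reasoning

      far-≤ : ∀ y → y ≤ p * z → ¬ ∣ x * x * x - y * y ∣ ≤ 2 * p
      far-≤ y y≤pz near with m≤n⇒∃[o]m+o≡n (*-mono-≤ y≤pz y≤pz)
      ... | d , y²+d≡[pz]² = p≰ 52 (n*n≤m*n⇒n≤m 52 p (≤-trans (m≤n*m (p * p) 24) (begin
        24 * (p * p)                ≡⟨ solve (p ∷ []) ⟩
        3 * (8 * (p * p))           ≡⟨ cong (3 *_) z+3a≡8p² ⟨
        3 * (z + 3 * a)             ≡⟨ solve (z ∷ a ∷ []) ⟩
        3 * z + 9 * a               ≤⟨ +-mono-≤ 3z≤16p (*-monoʳ-≤ 9 a≤4p) ⟩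
        8 * (2 * p) + 9 * (4 * p)   ≡⟨ solve (p ∷ []) ⟩
        52 * p                      ∎)))
        where
        open ≤-Reasoning
        balance : 8 * (x * x * x) + 0 ≡ 8 * (y * y) + (8 * d + (3 * a * a * z + a * a * a))
        balance = begin-equality
          8 * (x * x * x) + 0                                   ≡⟨ +-identityʳ _ ⟩
          8 * (x * x * x)                                       ≡⟨ 8x³≡ ⟩
          8 * (p * p) * z * z + (3 * a * a * z + a * a * a)     ≡⟨ solve (p ∷ z ∷ a ∷ []) ⟩
          8 * (p * z * (p * z)) + (3 * a * a * z + a * a * a)   ≡⟨ cong (λ s → 8 * s + (3 * a * a * z + a * a * a)) y²+d≡[pz]² ⟨
          8 * (y * y + d) + (3 * a * a * z + a * a * a)         ≡⟨ cong (_+ (3 * a * a * z + a * a * a)) (*-distribˡ-+ 8 (y * y) d) ⟩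
          8 * (y * y) + 8 * d + (3 * a * a * z + a * a * a)     ≡⟨ +-assoc (8 * (y * y)) (8 * d) _ ⟩
          8 * (y * y) + (8 * d + (3 * a * a * z + a * a * a))   ∎
        3z≤16p : 3 * z ≤ 8 * (2 * p)
        3z≤16p = begin
          3 * z                                   ≤⟨ *-monoˡ-≤ z (*-mono-≤ (*-monoʳ-≤ 3 1≤a) 1≤a) ⟩
          3 * a * a * z                           ≤⟨ m≤m+n _ (a * a * a) ⟩
          3 * a * a * z + a * a * a               ≤⟨ m≤n+m _ (8 * d) ⟩
          8 * d + (3 * a * a * z + a * a * a)     ≤⟨ ∣-∣-balance 8 (x * x * x) (y * y) 0 _ balance ⟩
          8 * ∣ x * x * x - y * y ∣               ≤⟨ *-monoʳ-≤ 8 near ⟩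
          8 * (2 * p)                             ∎

      module _ (t : ℕ) (near : ∣ x * x * x - (p * z + t) * (p * z + t) ∣ ≤ 2 * p) where

        private
          k : ℕ
          k = ∣ x * x * x - (p * z + t) * (p * z + t) ∣
          8k≤16p : 8 * k ≤ 8 * (2 * p)
          8k≤16p = *-monoʳ-≤ 8 near

          balance : 8 * (x * x * x) + (16 * p * t * z + 8 * t * t) ≡ 8 * ((p * z + t) * (p * z + t)) + (3 * a * a * z + a * a * a)
          balance = begin
            8 * (x * x * x) + (16 * p * t * z + 8 * t * t)                          ≡⟨ cong (_+ (16 * p * t * z + 8 * t * t)) 8x³≡ ⟩
            8 * (p * p) * z * z + (3 * a * a * z + a * a * a) + (16 * p * t * z + 8 * t * t) ≡⟨ solve (p ∷ z ∷ t ∷ a ∷ []) ⟩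
            8 * ((p * z + t) * (p * z + t)) + (3 * a * a * z + a * a * a)           ∎
            where open ≡-Reasoning

        up : 16 * p * t * z + 8 * t * t ≤ 3 * a * a * z + a * a * a + 8 * (2 * p)
        up = ≤-trans (∣-∣-balance′ 8 (x * x * x) _ (16 * p * t * z + 8 * t * t) (3 * a * a * z + a * a * a) balance)
                     (+-monoʳ-≤ (3 * a * a * z + a * a * a) 8k≤16p)

        down : 3 * a * a * z + a * a * a ≤ 16 * p * t * z + 8 * t * t + 8 * (2 * p)
        down = ≤-trans (∣-∣-balance 8 (x * x * x) _ (16 * p * t * z + 8 * t * t) (3 * a * a * z + a * a * a) balance)
                       (+-monoʳ-≤ (16 * p * t * z + 8 * t * t) 8k≤16p)

        overshoot : 3 * a * a < 16 * p * t → ⊥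
        overshoot lt = <⇒≱ 9a+7<3a²+16p (+-cancelˡ-≤ (a * a * a + 3 * a + 1 + 16 * p) _ _ (begin
          (a * a * a + 3 * a + 1 + 16 * p) + (3 * a * a + 16 * p) ≡⟨ solve (a ∷ p ∷ []) ⟩
          (a + 1) * (a + 1) * (a + 1) + 32 * p                    ≤⟨ [a+1]³+32p≤32p²+8 ⟩
          32 * (p * p) + 8                                        ≡⟨ solve (p ∷ []) ⟩
          4 * (8 * (p * p)) + 8                                   ≡⟨ cong (λ s → 4 * s + 8) z+3a≡8p² ⟨
          4 * (z + 3 * a) + 8                                     ≡⟨ solve (z ∷ a ∷ []) ⟩
          4 * z + (12 * a + 8)                                    ≤⟨ +-monoˡ-≤ (12 * a + 8) 4z≤ ⟩
          a * a * a + 8 * (2 * p) + (12 * a + 8)                  ≡⟨ solve (a ∷ p ∷ []) ⟩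
          (a * a * a + 3 * a + 1 + 16 * p) + (9 * a + 7)          ∎))
          where
          open ≤-Reasoning
          3a²+4≤16pt : 3 * a * a + 4 ≤ 16 * p * t
          3a²+4≤16pt = subst (3 * a * a + 4 ≤_) (sym (16pt≡2pt*8 p t)) (3n²<8w⇒3n²+4≤8w a (2 * p * t) (subst (3 * a * a <_) (16pt≡2pt*8 p t) lt))
          4z≤ : 4 * z ≤ a * a * a + 8 * (2 * p)
          4z≤ = +-cancelˡ-≤ (3 * a * a * z) _ _ (begin
            3 * a * a * z + 4 * z                  ≡⟨ *-distribʳ-+ z (3 * a * a) 4 ⟨
            (3 * a * a + 4) * z                    ≤⟨ *-monoˡ-≤ z 3a²+4≤16pt ⟩
            16 * p * t * z                         ≤⟨ m≤m+n _ (8 * t * t) ⟩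
            16 * p * t * z + 8 * t * t             ≤⟨ up ⟩
            3 * a * a * z + a * a * a + 8 * (2 * p) ≡⟨ +-assoc (3 * a * a * z) _ _ ⟩
            3 * a * a * z + (a * a * a + 8 * (2 * p)) ∎)
          9a+7<3a²+16p : 9 * a + 7 < 3 * a * a + 16 * p
          9a+7<3a²+16p = begin-strict
            9 * a + 7                 ≤⟨ +-monoˡ-≤ 7 (9n≤3n²+6 a) ⟩
            3 * a * a + 6 + 7         ≡⟨ +-assoc (3 * a * a) 6 7 ⟩
            3 * a * a + 13            <⟨ +-monoʳ-< (3 * a * a) (≤-trans (≤ᵇ⇒≤ 14 16 _) (m≤m*n 16 p)) ⟩
            3 * a * a + 16 * p        ∎

        exact : 1 ≤ t → 3 * a * a ≡ 16 * p * t → ⊥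
        exact 1≤t eq = p≰ 10 (*-cancelˡ-≤ 16 (begin
          16 * p        ≤⟨ 16p≤3a² ⟩
          3 * a * a     ≤⟨ *-mono-≤ (*-monoʳ-≤ 3 a≤7) a≤7 ⟩
          147           ≤⟨ ≤ᵇ⇒≤ 147 160 _ ⟩
          16 * 10       ∎))
          where
          open ≤-Reasoning
          16p≤3a² : 16 * p ≤ 3 * a * a
          16p≤3a² = ≤-trans (m≤m*n (16 * p) t {{>-nonZero 1≤t}}) (≤-reflexive (sym eq))
          a³≤8t²+16p : a * a * a ≤ 8 * t * t + 8 * (2 * p)
          a³≤8t²+16p = +-cancelˡ-≤ (16 * p * t * z) _ _ (begin
            16 * p * t * z + a * a * a               ≡⟨ cong (λ s → s * z + a * a * a) eq ⟨
            3 * a * a * z + a * a * a                ≤⟨ down ⟩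
            16 * p * t * z + 8 * t * t + 8 * (2 * p) ≡⟨ +-assoc (16 * p * t * z) _ _ ⟩
            16 * p * t * z + (8 * t * t + 8 * (2 * p)) ∎)
          4t≤3a : 4 * t ≤ 3 * a
          4t≤3a = *-cancelʳ-≤ (4 * t) (3 * a) (4 * p) {{m*n≢0 4 p}} (begin
            4 * t * (4 * p)   ≡⟨ solve (t ∷ p ∷ []) ⟩
            16 * p * t        ≡⟨ eq ⟨
            3 * a * a         ≤⟨ *-monoʳ-≤ (3 * a) a≤4p ⟩
            3 * a * (4 * p)   ∎)
          2a≤15 : 2 * a ≤ 15
          2a≤15 = *-cancelˡ-≤ (a * a) {{>-nonZero (*-mono-≤ 1≤a 1≤a)}} (begin
            a * a * (2 * a)                    ≡⟨ solve (a ∷ []) ⟩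
            2 * (a * a * a)                    ≤⟨ *-monoʳ-≤ 2 a³≤8t²+16p ⟩
            2 * (8 * t * t + 8 * (2 * p))      ≡⟨ solve (t ∷ p ∷ []) ⟩
            4 * t * (4 * t) + 2 * (16 * p)     ≤⟨ +-mono-≤ (*-mono-≤ 4t≤3a 4t≤3a) (*-monoʳ-≤ 2 16p≤3a²) ⟩
            3 * a * (3 * a) + 2 * (3 * a * a)  ≡⟨ solve (a ∷ []) ⟩
            a * a * 15                         ∎)
          a≤7 : a ≤ 7
          a≤7 = ≤-pred (*-cancelˡ-< 2 a 8 (s≤s 2a≤15))

        undershoot : 16 * p * t < 3 * a * a → ⊥
        undershoot lt = p≰ 36 (n*n≤m*n⇒n≤m 36 p (≤-trans (m≤n*m (p * p) 8) (begin
          8 * (p * p)                          ≡⟨ z+3a≡8p² ⟨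
          z + 3 * a                            ≤⟨ +-mono-≤ z≤ (*-monoʳ-≤ 3 a≤4p) ⟩
          8 * t * t + 8 * (2 * p) + 3 * (4 * p) ≤⟨ +-monoˡ-≤ (3 * (4 * p)) (+-monoˡ-≤ (8 * (2 * p)) 8t²≤8p) ⟩
          8 * p + 8 * (2 * p) + 3 * (4 * p)    ≡⟨ solve (p ∷ []) ⟩
          36 * p                               ∎)))
          where
          open ≤-Reasoning
          z≤ : z ≤ 8 * t * t + 8 * (2 * p)
          z≤ = +-cancelˡ-≤ (16 * p * t * z) _ _ (begin
            16 * p * t * z + z                        ≡⟨ +-comm (16 * p * t * z) z ⟩
            suc (16 * p * t) * z                      ≤⟨ *-monoˡ-≤ z lt ⟩
            3 * a * a * z                             ≤⟨ m≤m+n _ (a * a * a) ⟩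
            3 * a * a * z + a * a * a                 ≤⟨ down ⟩
            16 * p * t * z + 8 * t * t + 8 * (2 * p)  ≡⟨ +-assoc (16 * p * t * z) _ _ ⟩
            16 * p * t * z + (8 * t * t + 8 * (2 * p)) ∎)
          8t²≤8p : 8 * t * t ≤ 8 * p
          8t²≤8p = ≤-trans (≤-reflexive (*-assoc 8 t t)) (*-monoʳ-≤ 8 (<⇒≤ (16pt<3a²⇒t²<p a t a³≤32p² lt)))

      far-shifted : ∀ t → 1 ≤ t → ¬ ∣ x * x * x - (p * z + t) * (p * z + t) ∣ ≤ 2 * p
      far-shifted t 1≤t near with <-cmp (3 * a * a) (16 * p * t)
      ... | tri< lt _ _ = overshoot t near lt
      ... | tri≈ _ eq _ = exact t near 1≤t eq
      ... | tri> _ _ gt = undershoot t near gt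

      far-from-squares : ∀ y → ¬ ∣ x * x * x - y * y ∣ ≤ 2 * p
      far-from-squares = split-at (λ y → ¬ ∣ x * x * x - y * y ∣ ≤ 2 * p) (p * z) far-≤ far-shifted

    far : ∀ y → 2 * p < ∣ x * x * x - y * y ∣
    far y = ≰⇒> (far-from-squares (8 * (p * p) ∸ 3 * a) (m∸n+n≡m 3a≤8p²) y)
      where
      3a≤8p² : 3 * a ≤ 8 * (p * p)
      3a≤8p² = begin
        3 * a         ≤⟨ *-monoʳ-≤ 3 a≤4p ⟩
        3 * (4 * p)   ≡⟨ solve (p ∷ []) ⟩
        12 * p        ≤⟨ *-monoˡ-≤ p (≤-trans (≤ᵇ⇒≤ 12 800 _) (*-monoʳ-≤ 8 99<p)) ⟩
        8 * p * p     ≡⟨ *-assoc 8 p p ⟩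
        8 * (p * p)   ∎
        where open ≤-Reasoning

^3≡ : ∀ n → n ^ 3 ≡ n * n * n
^3≡ n = trans (cong (λ s → n * (n * s)) (*-identityʳ n)) (sym (*-assoc n n n))

[2p-1]²-expansion : ∀ c p → 1 ≤ p * 2 → c * (p * 2 ∸ 1) ^ 2 + 4 * c * p ≡ 4 * c * (p * p) + c
[2p-1]²-expansion c p 1≤2p = expansion (p * 2 ∸ 1) (m∸n+n≡m 1≤2p)
  where
  expansion : ∀ r → r + 1 ≡ p * 2 → c * (r * (r * 1)) + 4 * c * p ≡ 4 * c * (p * p) + c
  expansion r r+1≡2p = begin
    c * (r * (r * 1)) + 4 * c * p      ≡⟨ solve (c ∷ r ∷ p ∷ []) ⟩
    c * (r * r) + 2 * c * (p * 2)      ≡⟨ cong (λ s → c * (r * r) + 2 * c * s) r+1≡2p ⟨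
    c * (r * r) + 2 * c * (r + 1)      ≡⟨ solve (c ∷ r ∷ []) ⟩
    c * ((r + 1) * (r + 1)) + c        ≡⟨ cong (λ s → c * (s * s) + c) r+1≡2p ⟩
    c * (p * 2 * (p * 2)) + c          ≡⟨ solve (c ∷ p ∷ []) ⟩
    4 * c * (p * p) + c                ∎
    where open ≡-Reasoning

10¹⁸<x⇒99<p : ∀ p x → 10 ^ 18 < x → x ≤ 4 * (p * p) + 4 * p → 99 < p
10¹⁸<x⇒99<p p x 10¹⁸<x x≤ = ≰⇒> λ p≤99 → <⇒≱ 10¹⁸<x (begin
  x                      ≤⟨ x≤ ⟩
  4 * (p * p) + 4 * p    ≤⟨ +-mono-≤ (*-monoʳ-≤ 4 (*-mono-≤ p≤99 p≤99)) (*-monoʳ-≤ 4 p≤99) ⟩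
  4 * (99 * 99) + 4 * 99 ≤⟨ ≤ᵇ⇒≤ _ (10 ^ 18) _ ⟩
  10 ^ 18                ∎)
  where open ≤-Reasoning

hall⇒near-square : ∀ p x → IsHall x → x ≤ 4 * (p * p) + 4 * p → ∃[ y ] ∣ x * x * x - y * y ∣ ≤ 2 * p
hall⇒near-square p x (_ , k , ((y , ∣x³-y²∣≡k) , _) , k²<x) x≤ =
  y , subst (_≤ 2 * p) (trans (sym ∣x³-y²∣≡k) (cong (λ s → ∣ s - y * y ∣) (^3≡ x))) k≤2p
  where
  k≤2p : k ≤ 2 * p
  k≤2p = ≮⇒≥ λ 2p<k → <⇒≱ k²<x (begin
    x                            ≤⟨ x≤ ⟩
    4 * (p * p) + 4 * p          <⟨ n<1+n _ ⟩
    suc (4 * (p * p) + 4 * p)    ≡⟨ solve (p ∷ []) ⟩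
    suc (2 * p) * suc (2 * p)    ≤⟨ *-mono-≤ 2p<k 2p<k ⟩
    k * k                        ∎)
    where open ≤-Reasoning

hall-above-square : ∀ p a → 1 ≤ a → a ≤ 4 * p → IsHall (4 * (p * p) + a) → 10 ^ 18 < 4 * (p * p) + a →
                    24 * (p * p) + 6 < a * a * a + 24 * p
hall-above-square p a 1≤a a≤4p hall 10¹⁸<x = ≰⇒> λ a³+24p≤ →
  let y , near = hall⇒near-square p _ hall x≤ in
  <⇒≱ (AboveSquare.far (10¹⁸<x⇒99<p p _ 10¹⁸<x x≤) a 1≤a a³+24p≤ y) near
  where
  x≤ : 4 * (p * p) + a ≤ 4 * (p * p) + 4 * p
  x≤ = +-monoʳ-≤ (4 * (p * p)) a≤4p

hall-below-square : ∀ p a x → 1 ≤ a → a ≤ 4 * p → x + a ≡ 4 * (p * p) → IsHall x → 10 ^ 18 < x →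
                    32 * (p * p) + 8 < (a + 1) * (a + 1) * (a + 1) + 32 * p
hall-below-square p a x 1≤a a≤4p x+a≡4p² hall 10¹⁸<x = ≰⇒> λ [a+1]³+32p≤ →
  let y , near = hall⇒near-square p x hall x≤ in
  <⇒≱ (BelowSquare.far (10¹⁸<x⇒99<p p x 10¹⁸<x x≤) a x 1≤a a≤4p x+a≡4p² [a+1]³+32p≤ y) near
  where
  x≤ : x ≤ 4 * (p * p) + 4 * p
  x≤ = ≤-trans (≤-trans (m≤m+n x a) (≤-reflexive x+a≡4p²)) (m≤m+n _ (4 * p))

lemma5 : (n x : ℕ) → 2 ∣ n → 1 ≤ n → IsHall x → 10 ^ 18 < x →
    ((a : ℕ) → 1 ≤ a → a ≤ 2 * n → x ≡ n * n + a → 6 * (n ∸ 1) ^ 2 < a ^ 3)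
    × ((a : ℕ) → 1 ≤ a → a ≤ 2 * n ∸ 2 → x + a ≡ n * n → 8 * (n ∸ 1) ^ 2 < (a + 1) ^ 3)
lemma5 .(p * 2) x (divides p refl) 1≤n hall 10¹⁸<x = above , below
  where
  open ≤-Reasoning
  [2p]²≡4p² : p * 2 * (p * 2) ≡ 4 * (p * p)
  [2p]²≡4p² = solve (p ∷ [])
  2[2p]≡4p : 2 * (p * 2) ≡ 4 * p
  2[2p]≡4p = solve (p ∷ [])

  above : (a : ℕ) → 1 ≤ a → a ≤ 2 * (p * 2) → x ≡ p * 2 * (p * 2) + a → 6 * (p * 2 ∸ 1) ^ 2 < a ^ 3
  above a 1≤a a≤2n x≡n²+a = ≰⇒> λ a³≤ → <⇒≱ (hall-above-square p a 1≤a (≤-trans a≤2n (≤-reflexive 2[2p]≡4p))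
                                             (subst IsHall x≡ hall) (subst (10 ^ 18 <_) x≡ 10¹⁸<x)) (begin
    a * a * a + 24 * p                ≡⟨ cong (_+ 24 * p) (^3≡ a) ⟨
    a ^ 3 + 24 * p                    ≤⟨ +-monoˡ-≤ (24 * p) a³≤ ⟩
    6 * (p * 2 ∸ 1) ^ 2 + 24 * p      ≡⟨ [2p-1]²-expansion 6 p 1≤n ⟩
    24 * (p * p) + 6                  ∎)
    where
    x≡ : x ≡ 4 * (p * p) + a
    x≡ = trans x≡n²+a (cong (_+ a) [2p]²≡4p²)

  below : (a : ℕ) → 1 ≤ a → a ≤ 2 * (p * 2) ∸ 2 → x + a ≡ p * 2 * (p * 2) → 8 * (p * 2 ∸ 1) ^ 2 < (a + 1) ^ 3
  below a 1≤a a≤2n-2 x+a≡n² = ≰⇒> λ [a+1]³≤ → <⇒≱ (hall-below-square p a x 1≤a a≤4p (trans x+a≡n² [2p]²≡4p²) hall 10¹⁸<x) (begin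
    (a + 1) * (a + 1) * (a + 1) + 32 * p ≡⟨ cong (_+ 32 * p) (^3≡ (a + 1)) ⟨
    (a + 1) ^ 3 + 32 * p                 ≤⟨ +-monoˡ-≤ (32 * p) [a+1]³≤ ⟩
    8 * (p * 2 ∸ 1) ^ 2 + 32 * p         ≡⟨ [2p-1]²-expansion 8 p 1≤n ⟩
    32 * (p * p) + 8                     ∎)
    where
    a≤4p : a ≤ 4 * p
    a≤4p = ≤-trans a≤2n-2 (≤-trans (m∸n≤m _ 2) (≤-reflexive 2[2p]≡4p))
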